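{- Let $m$ be a positive integer and $h$ a nonnegative integer. The coefficient of $q^{m^2-h}$ in the polynomial $(-1)^m q^{\frac{m(m-1)}{2}}\prod_{j=0}^{m-1}\left(1-q^{m-j}\right)$ equals the parity-count of the set of $m$-bounded distinct partitions of $h$.
   Context: A distinct partition is a partition into pairwise distinct parts. An $m$-bounded partition is one whose largest part is at most $m$ and which has at most $m$ parts. The parity-count of a set of partitions is the number of its partitions with an even number of parts minus the number with an odd number of parts (the empty partition counts as having $0$ parts). -}

module Defs where

open import Data.Nat as ℕ using (ℕ; zero; suc; _<_; _≤_; _>_)
open import Data.Integer as ℤ using (ℤ; +_; -[1+_]; _+_; _*_; -_)
open import Data.List using (List; []; _∷_; length; map; replicate; _++_)
open import Data.List.Relation.Unary.All using (All)
open import Data.List.Relation.Unary.Linked using (Linked)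
open import Data.Nat.ListAction using (sum)
open import Data.Product using (_×_)
open import Relation.Binary.PropositionalEquality using (_≡_)

-- Polynomials in q with integer coefficients, as coefficient lists
-- (lowest degree first): a₀ ∷ a₁ ∷ … represents a₀ + a₁ q + ….
Poly : Set
Poly = List ℤ

infixl 6 _⊕_
infixl 7 _⊗_ _·_

_⊕_ : Poly → Poly → Poly
[]       ⊕ g        = g
f        ⊕ []       = f
(a ∷ f)  ⊕ (b ∷ g)  = (a + b) ∷ (f ⊕ g)

_·_ : ℤ → Poly → Poly
c · f = map (c *_) f

_⊗_ : Poly → Poly → Poly
[]      ⊗ g = []
(a ∷ f) ⊗ g = (a · g) ⊕ (+ 0 ∷ (f ⊗ g))

const : ℤ → Poly
const c = c ∷ []

qPow : ℕ → Poly
qPow k = replicate k (+ 0) ++ (+ 1 ∷ [])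

coeffℕ : Poly → ℕ → ℤ
coeffℕ []      _       = + 0
coeffℕ (a ∷ f) zero    = a
coeffℕ (a ∷ f) (suc k) = coeffℕ f k

coeff : Poly → ℤ → ℤ
coeff f (+ k)    = coeffℕ f k
coeff f -[1+ _ ] = + 0

prodP : ℕ → (ℕ → Poly) → Poly
prodP zero    F = const (+ 1)
prodP (suc n) F = prodP n F ⊗ F n

sgn : ℕ → ℤ
sgn zero    = + 1
sgn (suc m) = - sgn m

thePoly : ℕ → Poly
thePoly m =
  sgn m · (qPow (m ℕ.* (m ℕ.∸ 1) ℕ./ 2)
            ⊗ prodP m (λ j → const (+ 1) ⊕ (- + 1) · qPow (m ℕ.∸ j)))

-- A partition is represented as a list of its parts in weakly decreasing
-- order (all parts positive). It is distinct iff strictly decreasing.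
IsBoundedDistinctPartition : ℕ → ℕ → List ℕ → Set
IsBoundedDistinctPartition m h p =
  Linked (λ a b → b < a) p
  × All (λ a → 0 < a) p
  × All (λ a → a ≤ m) p
  × length p ≤ m
  × sum p ≡ h


partSign : List ℕ → ℤ
partSign p = sgn (length p)

parityCount : List (List ℕ) → ℤ
parityCount []       = + 0
parityCount (p ∷ ps) = partSign p + parityCount ps

-- Since ∏_{j<m} (1 - q^(m-j)) = ∏_{a=1}^{m} (1 - q^a), expanding the product gives one
-- term for each set S ⊆ {1, …, m} of factors from which 1 is taken: it is
-- (-1)^(m - |S|) q^(m(m+1)/2 - ΣS).  As m(m-1)/2 + m(m+1)/2 = m², the coefficient of
-- q^(m² - h) in (-1)^m q^(m(m-1)/2) ∏ … is the sum of (-1)^|S| over the sets S with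
-- ΣS = h, and such sets, listed in decreasing order, are exactly the m-bounded
-- distinct partitions of h.
module Submission where

open import Defs
open import Data.Nat using (ℕ; zero; suc; _∸_; _<_; _≤_; _>_; z≤n; s≤s)
import Data.Nat as ℕ
import Data.Nat.Properties as ℕ
open import Data.Nat.DivMod using (m*n/n≡m)
open import Data.Nat.ListAction using (sum)
open import Data.Nat.ListAction.Properties using (sum-++)
open import Data.Integer as ℤ using (ℤ; +_; -[1+_]; _+_; _*_; -_; _-_)
open import Data.Integer.Properties as ℤ using (+-identityʳ; *-identityʳ; *-zeroʳ; pos-+)
open import Data.Integer.Tactic.RingSolver using (solve-∀)
import Data.Nat.Tactic.RingSolver as NatSolver
open import Data.List using (List; []; _∷_; _++_; _∷ʳ_; map; filter; length)
open import Data.List.Properties using (length-++; filter-++; filter-≐; ∷ʳ-injectiveˡ)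
open import Data.List.Relation.Unary.All as All using (All; []; _∷_)
import Data.List.Relation.Unary.All.Properties as All
open import Data.List.Relation.Unary.Any using (here)
open import Data.List.Relation.Unary.Linked using (Linked; []; [-]; _∷_)
open import Data.List.Relation.Unary.AllPairs using ([]; _∷_)
open import Data.List.Membership.Propositional using (_∈_)
open import Data.List.Membership.Propositional.Properties
  using (∈-++⁺ˡ; ∈-++⁺ʳ; ∈-++⁻; ∈-map⁺; ∈-map⁻; ∈-filter⁺; ∈-filter⁻)
open import Data.List.Membership.Propositional.Properties.WithK using (unique∧set⇒bag)
open import Data.List.Relation.Binary.BagAndSetEquality using (∼bag⇒↭)
open import Data.List.Relation.Binary.Permutation.Propositional using (_↭_; refl; prep; swap; trans)
open import Data.List.Relation.Unary.Unique.Propositional using (Unique)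
import Data.List.Relation.Unary.Unique.Propositional.Properties as Unique
open import Data.Product using (_×_; _,_; proj₂; ∃)
open import Data.Sum using (_⊎_; inj₁; inj₂)
open import Data.Bool using (true; false)
open import Function using (_∘_; id)
open import Function.Bundles using (_⇔_; mk⇔)
open import Function.Properties.Equivalence using () renaming (trans to ⇔-trans; sym to ⇔-sym)
open import Relation.Binary.PropositionalEquality
  using (_≡_; refl; sym; cong; cong₂; subst; _≗_; module ≡-Reasoning)
  renaming (trans to ≡-trans)
open import Relation.Nullary using (¬_; does; yes; no; contradiction)
open import Relation.Unary using (Pred; Decidable; _⊆_; _≐_)
open import Level using (0ℓ)
open import Relation.Binary.Definitions using (Transitive)

δ₀ : ℤ → ℤ
δ₀ (+ zero)  = + 1
δ₀ (+ suc _) = + 0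
δ₀ -[1+ _ ]  = + 0

i-1-j≡i-[1+j] : ∀ i j → i - + 1 - j ≡ i - (+ 1 + j)
i-1-j≡i-[1+j] = solve-∀

coeff-1 : ∀ e → coeff (const (+ 1)) e ≡ δ₀ e
coeff-1 (+ zero)  = refl
coeff-1 (+ suc _) = refl
coeff-1 -[1+ _ ]  = refl

coeff-[] : ∀ e → coeff [] e ≡ + 0
coeff-[] (+ _)    = refl
coeff-[] -[1+ _ ] = refl

coeff-∷ : ∀ x f e → coeff (x ∷ f) e ≡ x * δ₀ e + coeff f (e - + 1)
coeff-∷ x f (+ zero)  = sym (≡-trans (+-identityʳ _) (*-identityʳ x))
coeff-∷ x f (+ suc k) = sym (≡-trans (cong (_+ coeffℕ f k) (*-zeroʳ x)) (ℤ.+-identityˡ _))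
coeff-∷ x f -[1+ k ]  = sym (≡-trans (+-identityʳ _) (*-zeroʳ x))

coeff-⊕ : ∀ f g e → coeff (f ⊕ g) e ≡ coeff f e + coeff g e
coeff-⊕ f g (+ k)    = coeffℕ-⊕ f g k
  where
  coeffℕ-⊕ : ∀ f g k → coeffℕ (f ⊕ g) k ≡ coeffℕ f k + coeffℕ g k
  coeffℕ-⊕ []      g       k       = sym (ℤ.+-identityˡ _)
  coeffℕ-⊕ (a ∷ f) []      k       = sym (+-identityʳ _)
  coeffℕ-⊕ (a ∷ f) (b ∷ g) zero    = refl
  coeffℕ-⊕ (a ∷ f) (b ∷ g) (suc k) = coeffℕ-⊕ f g k
coeff-⊕ f g -[1+ _ ] = refl

coeff-· : ∀ c f e → coeff (c · f) e ≡ c * coeff f e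
coeff-· c f (+ k)    = coeffℕ-· f k
  where
  coeffℕ-· : ∀ f k → coeffℕ (c · f) k ≡ c * coeffℕ f k
  coeffℕ-· []      k       = sym (*-zeroʳ c)
  coeffℕ-· (a ∷ f) zero    = refl
  coeffℕ-· (a ∷ f) (suc k) = coeffℕ-· f k
coeff-· c f -[1+ _ ] = sym (*-zeroʳ c)

coeff-0∷ : ∀ f e → coeff (+ 0 ∷ f) e ≡ coeff f (e - + 1)
coeff-0∷ f (+ zero)  = refl
coeff-0∷ f (+ suc k) = refl
coeff-0∷ f -[1+ k ]  = refl

coeff-∷-⊗ : ∀ x f g e → coeff ((x ∷ f) ⊗ g) e ≡ x * coeff g e + coeff (f ⊗ g) (e - + 1)
coeff-∷-⊗ x f g e = begin
  coeff ((x · g) ⊕ (+ 0 ∷ f ⊗ g)) e          ≡⟨ coeff-⊕ (x · g) _ e ⟩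
  coeff (x · g) e + coeff (+ 0 ∷ f ⊗ g) e    ≡⟨ cong₂ _+_ (coeff-· x g e) (coeff-0∷ (f ⊗ g) e) ⟩
  x * coeff g e + coeff (f ⊗ g) (e - + 1)    ∎
  where open ≡-Reasoning

coeff-qPow : ∀ a e → coeff (qPow a) e ≡ δ₀ (e - + a)
coeff-qPow zero    e = ≡-trans (coeff-1 e) (cong δ₀ (sym (+-identityʳ e)))
coeff-qPow (suc a) e =
  ≡-trans (coeff-0∷ (qPow a) e) (≡-trans (coeff-qPow a (e - + 1)) (cong δ₀ (i-1-j≡i-[1+j] e (+ a))))

coeff-qPow-⊗ : ∀ a g e → coeff (qPow a ⊗ g) e ≡ coeff g (e - + a)
coeff-qPow-⊗ zero    g e = begin
  coeff ((+ 1 ∷ []) ⊗ g) e                 ≡⟨ coeff-∷-⊗ (+ 1) [] g e ⟩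
  + 1 * coeff g e + coeff [] (e - + 1)     ≡⟨ cong (λ c → + 1 * coeff g e + c) (coeff-[] (e - + 1)) ⟩
  + 1 * coeff g e + + 0                    ≡⟨ ≡-trans (+-identityʳ _) (ℤ.*-identityˡ _) ⟩
  coeff g e                                ≡⟨ cong (coeff g) (sym (+-identityʳ e)) ⟩
  coeff g (e - + 0)                        ∎
  where open ≡-Reasoning
coeff-qPow-⊗ (suc a) g e = begin
  coeff ((+ 0 ∷ qPow a) ⊗ g) e                  ≡⟨ coeff-∷-⊗ (+ 0) (qPow a) g e ⟩
  + 0 * coeff g e + coeff (qPow a ⊗ g) (e - + 1) ≡⟨ ℤ.+-identityˡ _ ⟩
  coeff (qPow a ⊗ g) (e - + 1)                  ≡⟨ coeff-qPow-⊗ a g (e - + 1) ⟩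
  coeff g (e - + 1 - + a)                       ≡⟨ cong (coeff g) (i-1-j≡i-[1+j] e (+ a)) ⟩
  coeff g (e - + suc a)                         ∎
  where open ≡-Reasoning

1-q^_ : ℕ → Poly
1-q^ a = const (+ 1) ⊕ (- + 1) · qPow a

coeff-1-q^ : ∀ a e → coeff (1-q^ a) e ≡ δ₀ e - δ₀ (e - + a)
coeff-1-q^ a e = begin
  coeff (1-q^ a) e                                   ≡⟨ coeff-⊕ (const (+ 1)) _ e ⟩
  coeff (const (+ 1)) e + coeff ((- + 1) · qPow a) e ≡⟨ cong (_+ coeff ((- + 1) · qPow a) e) (coeff-1 e) ⟩
  δ₀ e + coeff ((- + 1) · qPow a) e                  ≡⟨ cong (λ c → δ₀ e + c) (coeff-· (- + 1) (qPow a) e) ⟩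
  δ₀ e + (- + 1) * coeff (qPow a) e                  ≡⟨ cong (λ c → δ₀ e + (- + 1) * c) (coeff-qPow a e) ⟩
  δ₀ e + (- + 1) * δ₀ (e - + a)                      ≡⟨ cong (λ c → δ₀ e + c) (ℤ.-1*i≡-i _) ⟩
  δ₀ e - δ₀ (e - + a)                                ∎
  where open ≡-Reasoning

coeff-⊗-1-q^ : ∀ f a e → coeff (f ⊗ 1-q^ a) e ≡ coeff f e - coeff f (e - + a)
coeff-⊗-1-q^ []      a e = ≡-trans (coeff-[] e) (sym (cong₂ _-_ (coeff-[] e) (coeff-[] (e - + a))))
coeff-⊗-1-q^ (x ∷ f) a e = begin
  coeff ((x ∷ f) ⊗ 1-q^ a) e
    ≡⟨ coeff-∷-⊗ x f (1-q^ a) e ⟩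
  x * coeff (1-q^ a) e + coeff (f ⊗ 1-q^ a) (e - + 1)
    ≡⟨ cong₂ (λ c d → x * c + d) (coeff-1-q^ a e) (coeff-⊗-1-q^ f a (e - + 1)) ⟩
  x * (δ₀ e - δ₀ (e - + a)) + (coeff f (e - + 1) - coeff f (e - + 1 - + a))
    ≡⟨ cong (λ d → x * (δ₀ e - δ₀ (e - + a)) + (coeff f (e - + 1) - coeff f d)) (swap-subtractions e (+ a)) ⟩
  x * (δ₀ e - δ₀ (e - + a)) + (coeff f (e - + 1) - coeff f (e - + a - + 1))
    ≡⟨ regroup x (δ₀ e) (δ₀ (e - + a)) (coeff f (e - + 1)) (coeff f (e - + a - + 1)) ⟩
  (x * δ₀ e + coeff f (e - + 1)) - (x * δ₀ (e - + a) + coeff f (e - + a - + 1))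
    ≡⟨ sym (cong₂ _-_ (coeff-∷ x f e) (coeff-∷ x f (e - + a))) ⟩
  coeff (x ∷ f) e - coeff (x ∷ f) (e - + a)
    ∎
  where
  open ≡-Reasoning
  swap-subtractions : ∀ e a → e - + 1 - a ≡ e - a - + 1
  swap-subtractions = solve-∀
  regroup : ∀ x d d′ u v → x * (d - d′) + (u - v) ≡ (x * d + u) - (x * d′ + v)
  regroup = solve-∀

filter-map : ∀ {a b p} {A : Set a} {B : Set b} {P : Pred B p} (P? : Decidable P) (f : A → B) →
             filter P? ∘ map f ≗ map f ∘ filter (P? ∘ f)
filter-map P? f []       = refl
filter-map P? f (x ∷ xs) with does (P? (f x))
... | true  = cong (f x ∷_) (filter-map P? f xs)
... | false = filter-map P? f xs

sgn-suc : ∀ n → sgn (n ℕ.+ 1) ≡ - sgn n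
sgn-suc zero    = refl
sgn-suc (suc n) = cong -_ (sgn-suc n)

sgn-involutive : ∀ n x → sgn n * (sgn n * x) ≡ x
sgn-involutive zero    x = ≡-trans (ℤ.*-identityˡ _) (ℤ.*-identityˡ x)
sgn-involutive (suc n) x = ≡-trans (negate-twice (sgn n) x) (sgn-involutive n x)
  where
  negate-twice : ∀ s x → (- s) * ((- s) * x) ≡ s * (s * x)
  negate-twice = solve-∀

partSign-∷ʳ : ∀ p a → partSign (p ∷ʳ a) ≡ - partSign p
partSign-∷ʳ p a = ≡-trans (cong sgn (length-++ p)) (sgn-suc (length p))

parityCount-++ : ∀ ps qs → parityCount (ps ++ qs) ≡ parityCount ps + parityCount qs
parityCount-++ []       qs = sym (ℤ.+-identityˡ _)
parityCount-++ (p ∷ ps) qs =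
  ≡-trans (cong (_+_ (partSign p)) (parityCount-++ ps qs)) (sym (ℤ.+-assoc (partSign p) _ _))

parityCount-map-∷ʳ : ∀ a ps → parityCount (map (_∷ʳ a) ps) ≡ - parityCount ps
parityCount-map-∷ʳ a []       = refl
parityCount-map-∷ʳ a (p ∷ ps) =
  ≡-trans (cong₂ _+_ (partSign-∷ʳ p a) (parityCount-map-∷ʳ a ps))
          (sym (ℤ.neg-distrib-+ (partSign p) (parityCount ps)))

parityCount-↭ : ∀ {ps qs} → ps ↭ qs → parityCount ps ≡ parityCount qs
parityCount-↭ refl          = refl
parityCount-↭ (prep p ps↭qs) = cong (_+_ (partSign p)) (parityCount-↭ ps↭qs)
parityCount-↭ (swap p q ps↭qs) =
  ≡-trans (cong (λ c → partSign p + (partSign q + c)) (parityCount-↭ ps↭qs))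
          (exchange (partSign p) (partSign q) _)
  where
  exchange : ∀ a b c → a + (b + c) ≡ b + (a + c)
  exchange = solve-∀
parityCount-↭ (trans ps↭qs qs↭rs) = ≡-trans (parityCount-↭ ps↭qs) (parityCount-↭ qs↭rs)

parityCount-cong : ∀ {ps qs} → Unique ps → Unique qs → (∀ p → p ∈ ps ⇔ p ∈ qs) →
                   parityCount ps ≡ parityCount qs
parityCount-cong ups uqs same =
  parityCount-↭ (∼bag⇒↭ (unique∧set⇒bag ups uqs (λ {p} → same p)))

HasSize : ℤ → Pred (List ℕ) 0ℓ
HasSize e p = + sum p ≡ e

hasSize? : ∀ e → Decidable (HasSize e)
hasSize? e p = + sum p ℤ.≟ e

parityCountOfSize : List (List ℕ) → ℤ → ℤ
parityCountOfSize ps e = parityCount (filter (hasSize? e) ps)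

parityCountOfSize-++ : ∀ ps qs e →
  parityCountOfSize (ps ++ qs) e ≡ parityCountOfSize ps e + parityCountOfSize qs e
parityCountOfSize-++ ps qs e =
  ≡-trans (cong parityCount (filter-++ (hasSize? e) ps qs))
          (parityCount-++ (filter (hasSize? e) ps) (filter (hasSize? e) qs))

sum-∷ʳ : ∀ p a → + sum (p ∷ʳ a) ≡ + sum p + + a
sum-∷ʳ p a = ≡-trans (cong +_ (≡-trans (sum-++ p (a ∷ [])) (cong (sum p ℕ.+_) (ℕ.+-identityʳ a))))
                     (pos-+ (sum p) a)

HasSize-∷ʳ : ∀ a e → HasSize e ∘ (_∷ʳ a) ≐ HasSize (e - + a)
HasSize-∷ʳ a e = (λ {p} → to {p}) , (λ {p} → from {p})
  where
  add-sub : ∀ x y → x + y - y ≡ x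
  add-sub = solve-∀
  sub-add : ∀ x y → x - y + y ≡ x
  sub-add = solve-∀
  to : HasSize e ∘ (_∷ʳ a) ⊆ HasSize (e - + a)
  to {p} size = ≡-trans (sym (add-sub (+ sum p) (+ a))) (cong (_- + a) (≡-trans (sym (sum-∷ʳ p a)) size))
  from : HasSize (e - + a) ⊆ HasSize e ∘ (_∷ʳ a)
  from {p} size = ≡-trans (sum-∷ʳ p a) (≡-trans (cong (_+ + a) size) (sub-add e (+ a)))

parityCountOfSize-map-∷ʳ : ∀ a ps e →
  parityCountOfSize (map (_∷ʳ a) ps) e ≡ - parityCountOfSize ps (e - + a)
parityCountOfSize-map-∷ʳ a ps e = begin
  parityCount (filter (hasSize? e) (map (_∷ʳ a) ps))
    ≡⟨ cong parityCount (filter-map (hasSize? e) (_∷ʳ a) ps) ⟩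
  parityCount (map (_∷ʳ a) (filter (hasSize? e ∘ (_∷ʳ a)) ps))
    ≡⟨ parityCount-map-∷ʳ a (filter (hasSize? e ∘ (_∷ʳ a)) ps) ⟩
  - parityCount (filter (hasSize? e ∘ (_∷ʳ a)) ps)
    ≡⟨ cong (λ qs → - parityCount qs) (filter-≐ (hasSize? e ∘ (_∷ʳ a)) (hasSize? (e - + a)) (HasSize-∷ʳ a e) ps) ⟩
  - parityCount (filter (hasSize? (e - + a)) ps)
    ∎
  where open ≡-Reasoning

subsequences : (ℕ → ℕ) → ℕ → List (List ℕ)
subsequences a zero    = [] ∷ []
subsequences a (suc n) = subsequences a n ++ map (_∷ʳ a n) (subsequences a n)

partialSum : (ℕ → ℕ) → ℕ → ℕ
partialSum a zero    = 0
partialSum a (suc n) = partialSum a n ℕ.+ a n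

-- A subsequence p lists the factors from which the term 1 is taken; the other factors
-- contribute -q^(a j), so p contributes (-1)^(n - length p) q^(partialSum a n - Σp).
coeff-prodP-1-q^ : ∀ a n e →
  coeff (prodP n (λ j → 1-q^ a j)) e ≡ sgn n * parityCountOfSize (subsequences a n) (+ partialSum a n - e)
coeff-prodP-1-q^ a zero    (+ zero)  = refl
coeff-prodP-1-q^ a zero    (+ suc _) = refl
coeff-prodP-1-q^ a zero    -[1+ _ ]  = refl
coeff-prodP-1-q^ a (suc n) e = begin
  coeff (P ⊗ 1-q^ x) e
    ≡⟨ coeff-⊗-1-q^ P x e ⟩
  coeff P e - coeff P (e - + x)
    ≡⟨ cong₂ _-_ (coeff-prodP-1-q^ a n e) (coeff-prodP-1-q^ a n (e - + x)) ⟩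
  s * C S (+ D - e) - s * C S (+ D - (e - + x))
    ≡⟨ cong₂ (λ u v → s * C S u - s * C S v) (sym (shift-out (+ D) (+ x) e)) (sym (shift-in (+ D) (+ x) e)) ⟩
  s * C S (+ D + + x - e - + x) - s * C S (+ D + + x - e)
    ≡⟨ factor-sign s _ _ ⟩
  (- s) * (C S (+ D + + x - e) + - C S (+ D + + x - e - + x))
    ≡⟨ cong (λ c → (- s) * (C S (+ D + + x - e) + c)) (sym (parityCountOfSize-map-∷ʳ x S _)) ⟩
  (- s) * (C S (+ D + + x - e) + C (map (_∷ʳ x) S) (+ D + + x - e))
    ≡⟨ cong ((- s) *_) (sym (parityCountOfSize-++ S (map (_∷ʳ x) S) _)) ⟩
  (- s) * C (subsequences a (suc n)) (+ D + + x - e)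
    ≡⟨ cong (λ d → (- s) * C (subsequences a (suc n)) (d - e)) (sym (pos-+ D x)) ⟩
  (- s) * C (subsequences a (suc n)) (+ (D ℕ.+ x) - e)
    ∎
  where
  open ≡-Reasoning
  C = parityCountOfSize
  x = a n
  P = prodP n (λ j → 1-q^ a j)
  s = sgn n
  S = subsequences a n
  D = partialSum a n
  shift-in : ∀ d x e → d + x - e ≡ d - (e - x)
  shift-in = solve-∀
  shift-out : ∀ d x e → d + x - e - x ≡ d - e
  shift-out = solve-∀
  factor-sign : ∀ s u v → s * u - s * v ≡ (- s) * (v + - u)
  factor-sign = solve-∀

module _ {R : ℕ → ℕ → Set} where

  Linked-∷ʳ⁺ : ∀ {q a} → Linked R q → All (λ x → R x a) q → Linked R (q ∷ʳ a)
  Linked-∷ʳ⁺ []          []              = [-]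
  Linked-∷ʳ⁺ [-]         (Rxa ∷ [])      = Rxa ∷ [-]
  Linked-∷ʳ⁺ (Rxy ∷ Rq)  (_ ∷ Rqa)       = Rxy ∷ Linked-∷ʳ⁺ Rq Rqa

  Linked-∷ʳ⁻ : Transitive R → ∀ q {a} → Linked R (q ∷ʳ a) → Linked R q × All (λ x → R x a) q
  Linked-∷ʳ⁻ _     []          _           = [] , []
  Linked-∷ʳ⁻ _     (x ∷ [])    (Rxa ∷ _)   = [-] , Rxa ∷ []
  Linked-∷ʳ⁻ R-trans (x ∷ y ∷ q) (Rxy ∷ Rq) with Linked-∷ʳ⁻ R-trans (y ∷ q) Rq
  ... | Ryq , Rya ∷ Rqa = Rxy ∷ Ryq , R-trans Rxy Rya ∷ Rya ∷ Rqa

>-trans : ∀ {x y z} → x > y → y > z → x > z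
>-trans x>y y>z = ℕ.<-trans y>z x>y

length-∈-subsequences : ∀ a n {p} → p ∈ subsequences a n → length p ≤ n
length-∈-subsequences a zero    (here refl) = z≤n
length-∈-subsequences a (suc n) {p} p∈ with ∈-++⁻ (subsequences a n) p∈
... | inj₁ p∈S = ℕ.m≤n⇒m≤1+n (length-∈-subsequences a n p∈S)
... | inj₂ p∈S∷ʳ with ∈-map⁻ (_∷ʳ a n) p∈S∷ʳ
...   | q , q∈S , refl = ℕ.≤-trans (ℕ.≤-reflexive (≡-trans (length-++ q) (ℕ.+-comm (length q) 1)))
                                    (s≤s (length-∈-subsequences a n q∈S))

above-or-∷ʳ : ∀ a p → Linked _>_ p → All (a ≤_) p → All (a <_) p ⊎ ∃ λ q → p ≡ q ∷ʳ a
above-or-∷ʳ a []          _           _          = inj₁ []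
above-or-∷ʳ a (x ∷ [])    _           (a≤x ∷ []) with a ℕ.≟ x
... | yes refl = inj₂ ([] , refl)
... | no  a≢x  = inj₁ (ℕ.≤∧≢⇒< a≤x a≢x ∷ [])
above-or-∷ʳ a (x ∷ y ∷ p) (x>y ∷ dec) (_ ∷ a≤yp) with above-or-∷ʳ a (y ∷ p) dec a≤yp
... | inj₁ (a<y ∷ a<p) = inj₁ (ℕ.<-trans a<y x>y ∷ a<y ∷ a<p)
... | inj₂ (q , yp≡q∷ʳa) = inj₂ (x ∷ q , cong (x ∷_) yp≡q∷ʳa)

module _ (m : ℕ) where

  private
    ∸-suc : ∀ {n} → n < m → suc (m ∸ suc n) ≡ m ∸ n
    ∸-suc n<m = sym (ℕ.+-∸-assoc 1 n<m)

    ∸-suc-weaken : ∀ n {x} → m ∸ n < x → m ∸ suc n < x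
    ∸-suc-weaken n = ℕ.≤-<-trans (ℕ.∸-monoʳ-≤ m (ℕ.n≤1+n n))

  ∈-subsequences⁻ : ∀ n {p} → n ≤ m → p ∈ subsequences (m ∸_) n →
                    Linked _>_ p × All (m ∸ n <_) p × All (_≤ m) p
  ∈-subsequences⁻ zero    _    (here refl) = [] , [] , []
  ∈-subsequences⁻ (suc n) n<m p∈ with ∈-++⁻ (subsequences (m ∸_) n) p∈
  ... | inj₁ p∈S with ∈-subsequences⁻ n (ℕ.<⇒≤ n<m) p∈S
  ...   | dec , above , bounded = dec , All.map (∸-suc-weaken n) above , bounded
  ∈-subsequences⁻ (suc n) n<m p∈ | inj₂ p∈S∷ʳ with ∈-map⁻ (_∷ʳ (m ∸ n)) p∈S∷ʳ
  ... | q , q∈S , refl with ∈-subsequences⁻ n (ℕ.<⇒≤ n<m) q∈S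
  ...   | dec , above , bounded =
          Linked-∷ʳ⁺ dec above ,
          All.∷ʳ⁺ (All.map (∸-suc-weaken n) above) (ℕ.≤-reflexive (∸-suc n<m)) ,
          All.∷ʳ⁺ bounded (ℕ.m∸n≤m m n)

  ∈-subsequences⁺ : ∀ n {p} → n ≤ m → Linked _>_ p → All (m ∸ n <_) p → All (_≤ m) p →
                    p ∈ subsequences (m ∸_) n
  ∈-subsequences⁺ zero    {[]}    _   _   _         _              = here refl
  ∈-subsequences⁺ zero    {x ∷ p} _   _   (m<x ∷ _) (x≤m ∷ _)      = contradiction x≤m (ℕ.<⇒≱ m<x)
  ∈-subsequences⁺ (suc n) {p}     n<m dec above     bounded
    with above-or-∷ʳ (m ∸ n) p dec (All.map (λ {x} → subst (_≤ x) (∸-suc n<m)) above)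
  ... | inj₁ above′      = ∈-++⁺ˡ (∈-subsequences⁺ n (ℕ.<⇒≤ n<m) dec above′ bounded)
  ... | inj₂ (q , refl) with Linked-∷ʳ⁻ >-trans q dec
  ...   | decq , aboveq =
          ∈-++⁺ʳ (subsequences (m ∸_) n) (∈-map⁺ (_∷ʳ (m ∸ n))
            (∈-subsequences⁺ n (ℕ.<⇒≤ n<m) decq aboveq (All.++⁻ˡ q bounded)))

  subsequences-unique : ∀ n → n ≤ m → Unique (subsequences (m ∸_) n)
  subsequences-unique zero    _   = [] ∷ []
  subsequences-unique (suc n) n<m =
    Unique.++⁺ unique (Unique.map⁺ (∷ʳ-injectiveˡ _ _) unique) disjoint
    where
    unique = subsequences-unique n (ℕ.<⇒≤ n<m)
    disjoint : ∀ {p} → ¬ (p ∈ subsequences (m ∸_) n × p ∈ map (_∷ʳ (m ∸ n)) (subsequences (m ∸_) n))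
    disjoint (p∈S , p∈S∷ʳ) with ∈-map⁻ (_∷ʳ (m ∸ n)) p∈S∷ʳ
    ... | q , _ , refl with ∈-subsequences⁻ n (ℕ.<⇒≤ n<m) p∈S
    ...   | _ , above , _ = ℕ.<-irrefl refl (proj₂ (All.∷ʳ⁻ above))

boundedDistinctPartitions : ℕ → ℕ → List (List ℕ)
boundedDistinctPartitions m h = filter (hasSize? (+ h)) (subsequences (m ∸_) m)

boundedDistinctPartitions-unique : ∀ m h → Unique (boundedDistinctPartitions m h)
boundedDistinctPartitions-unique m h = Unique.filter⁺ (hasSize? (+ h)) (subsequences-unique m m ℕ.≤-refl)

∈-boundedDistinctPartitions : ∀ m h p → p ∈ boundedDistinctPartitions m h ⇔ IsBoundedDistinctPartition m h p
∈-boundedDistinctPartitions m h p = mk⇔ to from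
  where
  to : p ∈ boundedDistinctPartitions m h → IsBoundedDistinctPartition m h p
  to p∈ with ∈-filter⁻ (hasSize? (+ h)) p∈
  ... | p∈S , size with ∈-subsequences⁻ m m ℕ.≤-refl p∈S
  ...   | dec , above , bounded =
          dec , subst (λ k → All (k <_) p) (ℕ.n∸n≡0 m) above , bounded ,
          length-∈-subsequences (m ∸_) m p∈S , ℤ.+-injective size
  from : IsBoundedDistinctPartition m h p → p ∈ boundedDistinctPartitions m h
  from (dec , positive , bounded , _ , size) =
    ∈-filter⁺ (hasSize? (+ h))
      (∈-subsequences⁺ m m ℕ.≤-refl dec (subst (λ k → All (k <_) p) (sym (ℕ.n∸n≡0 m)) positive) bounded)
      (cong +_ size)

triangular : ∀ n → partialSum id n ℕ.* 2 ≡ n ℕ.* (n ∸ 1)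
triangular zero          = refl
triangular (suc zero)    = refl
triangular (suc (suc n)) =
  ≡-trans (ℕ.*-distribʳ-+ 2 (partialSum id (suc n)) (suc n))
          (≡-trans (cong (ℕ._+ suc n ℕ.* 2) (triangular (suc n))) (expand n))
  where
  expand : ∀ n → suc n ℕ.* n ℕ.+ suc n ℕ.* 2 ≡ suc (suc n) ℕ.* suc n
  expand = NatSolver.solve-∀

triangular-half : ∀ n → n ℕ.* (n ∸ 1) ℕ./ 2 ≡ partialSum id n
triangular-half n = ≡-trans (cong (ℕ._/ 2) (sym (triangular n))) (m*n/n≡m (partialSum id n) 2)

partialSum-∸-+-id : ∀ m n → n ≤ m → partialSum (m ∸_) n ℕ.+ partialSum id n ≡ n ℕ.* m
partialSum-∸-+-id m zero    _   = refl
partialSum-∸-+-id m (suc n) n<m =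
  ≡-trans (interchange (partialSum (m ∸_) n) (partialSum id n) (m ∸ n) n)
  (≡-trans (cong₂ ℕ._+_ (partialSum-∸-+-id m n (ℕ.<⇒≤ n<m)) (ℕ.m∸n+n≡m (ℕ.<⇒≤ n<m)))
           (ℕ.+-comm (n ℕ.* m) m))
  where
  interchange : ∀ a b c d → (a ℕ.+ c) ℕ.+ (b ℕ.+ d) ≡ (a ℕ.+ b) ℕ.+ (c ℕ.+ d)
  interchange = NatSolver.solve-∀

lemma3 : (m h : ℕ) → 0 Data.Nat.< m →
    (L : List (List ℕ)) → Unique L →
    (∀ p → (p ∈ L) ⇔ IsBoundedDistinctPartition m h p) →
    coeff (thePoly m) (+ (m Data.Nat.* m) - + h) ≡ parityCount L
lemma3 m h _ L uniqueL L⇔ = begin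
  coeff (thePoly m) e                                  ≡⟨ coeff-· (sgn m) (qPow t ⊗ P) e ⟩
  sgn m * coeff (qPow t ⊗ P) e                         ≡⟨ cong (sgn m *_) (coeff-qPow-⊗ t P e) ⟩
  sgn m * coeff P (e - + t)                            ≡⟨ cong (sgn m *_) (coeff-prodP-1-q^ (m ∸_) m (e - + t)) ⟩
  sgn m * (sgn m * parityCountOfSize S (+ D - (e - + t))) ≡⟨ sgn-involutive m _ ⟩
  parityCountOfSize S (+ D - (e - + t))                ≡⟨ cong (parityCountOfSize S) complement ⟩
  parityCount (boundedDistinctPartitions m h)          ≡⟨ parityCount-cong (boundedDistinctPartitions-unique m h) uniqueL same ⟩
  parityCount L                                        ∎
  where
  open ≡-Reasoning
  e = + (m ℕ.* m) - + h
  t = m ℕ.* (m ∸ 1) ℕ./ 2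
  P = prodP m (λ j → 1-q^ (m ∸ j))
  S = subsequences (m ∸_) m
  D = partialSum (m ∸_) m
  D+t≡m*m : D ℕ.+ t ≡ m ℕ.* m
  D+t≡m*m = ≡-trans (cong (D ℕ.+_) (triangular-half m)) (partialSum-∸-+-id m m ℕ.≤-refl)
  complement : + D - (e - + t) ≡ + h
  complement = ≡-trans (cong (λ k → + D - (k - + h - + t)) (≡-trans (cong +_ (sym D+t≡m*m)) (pos-+ D t)))
                       (cancel (+ D) (+ t) (+ h))
    where
    cancel : ∀ d t h → d - (d + t - h - t) ≡ h
    cancel = solve-∀
  same : ∀ p → p ∈ boundedDistinctPartitions m h ⇔ p ∈ L
  same p = ⇔-trans (∈-boundedDistinctPartitions m h p) (⇔-sym (L⇔ p))
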